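{- Let $k\ge4$, $n=2k-1$, $\lambda\in\overline{\mathcal{U}}_{T_n}$, and let $Y_{S_\lambda}$ be its Keith--Nath Young diagram with hook lengths $h_{i,j}$. Then there exists an integer $1\le z\le n-2$ such that $h_{1,z+1}=n-2$.
   Context: Partitions into distinct parts: $\lambda=(\lambda_1<\dots<\lambda_t)$, $t\ge2$. Missing parts $\mathcal{M}_\lambda=\{1,\dots,\lambda_t\}\setminus\{\lambda_i\}$. Unrefinable: no two distinct missing parts sum to a part. Maximal: largest part is maximum among unrefinable partitions of the same integer. $\overline{\mathcal{U}}_N$: maximal unrefinable partitions of $N$ with $\#\mathcal{M}_\lambda=\lfloor\lambda_t/2\rfloor$ (for $N=T_n$, $n\ge6$, these have $\lambda_t=2n-4$). $T_n=n(n+1)/2$. $S_\lambda=\mathbb{N}_0\setminus\lambda$; $Y_{S_\lambda}$ (English convention) has one row per part $g$ of $\lambda$, ordered top to bottom by decreasing $g$, the row of $g$ having $\#\{s\in S_\lambda:s<g\}$ cells. $h_{i,j}$ is the hook length (arm + leg + 1) of the cell in row $i$, column $j$. -}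

module Defs where

open import Data.Nat using (ℕ; zero; suc; _+_; _*_; _∸_; _≤_; _<_; _≤?_; _<?_; _⊔_; ⌊_/2⌋)
open import Data.Nat.Properties using (_≟_)
open import Data.List using (List; []; _∷_; length; filter; upTo; map; foldr; reverse)
open import Data.Nat.ListAction using (sum)
open import Data.List.Relation.Unary.All using (All)
open import Data.List.Relation.Unary.AllPairs using (AllPairs)
open import Data.List.Membership.DecPropositional _≟_ using (_∈_; _∉_; _∈?_)
open import Data.Product using (_×_)
open import Relation.Nullary using (¬?)
open import Relation.Binary.PropositionalEquality using (_≡_; _≢_)

T : ℕ → ℕ
T zero = zero
T (suc n) = suc n + T n

IsDistinctPartition : List ℕ → Set
IsDistinctPartition l = AllPairs _<_ l × All (0 <_) l × 2 ≤ length l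

-- largest part λₜ (for an increasing list, the maximum = last element)
largest : List ℕ → ℕ
largest l = foldr _⊔_ 0 l

missing : List ℕ → List ℕ
missing l = filter (λ m → ¬? (m ∈? l)) (map suc (upTo (largest l)))

Unrefinable : List ℕ → Set
Unrefinable l = ∀ a b → a ∈ missing l → b ∈ missing l → a ≢ b → a + b ∉ l

Maximal : ℕ → List ℕ → Set
Maximal N l = ∀ m → IsDistinctPartition m → sum m ≡ N → Unrefinable m →
  largest m ≤ largest l

InUbar : ℕ → List ℕ → Set
InUbar N l = IsDistinctPartition l × sum l ≡ N × Unrefinable l × Maximal N l
  × length (missing l) ≡ ⌊ largest l /2⌋

-- Keith–Nath Young diagram Y_{S_λ}, S_λ = ℕ₀ \ λ: row lengths listed top to
-- bottom; one row per part g, by decreasing g, of length #{s ∈ S_λ : s < g}.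
rowOf : List ℕ → ℕ → ℕ
rowOf l g = length (filter (λ s → ¬? (s ∈? l)) (upTo g))

rows : List ℕ → List ℕ
rows l = map (rowOf l) (reverse l)

-- length of row i (1-indexed); 0 if no such row
rowLen : List ℕ → ℕ → ℕ
rowLen [] i = 0
rowLen (r ∷ rs) zero = 0
rowLen (r ∷ rs) (suc zero) = r
rowLen (r ∷ rs) (suc (suc i)) = rowLen rs (suc i)

-- hook length h_{i,j} = arm + leg + 1 of the cell (i,j) (1-indexed),
-- arm = row_i − j, leg = #{rows below i of length ≥ j}
hook : List ℕ → ℕ → ℕ → ℕ
hook [] i j = 0
hook (r ∷ rs) zero j = 0
hook (r ∷ rs) (suc zero) j = (r ∸ j) + length (filter (j ≤?_) rs) + 1
hook (r ∷ rs) (suc (suc i)) j = hook rs (suc i) j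

module Submission where

-- Write n2 = n − 2, let L = 2K + r + 1 (r ≤ 1) be the largest part of λ and
-- g t = 1 if t ∉ λ, else 0. Unrefinability with respect to the part L forbids t
-- and L − t to be both missing, while exactly ⌊L/2⌋ = K + r numbers below L are
-- missing: so each pair {t, L − t} (1 ≤ t ≤ K) contains exactly one part and,
-- if r = 1, the middle K + 1 is missing. The parts then add up to T K + E + L
-- with E = Σ g t (2(K − t) + r + 1).
-- By maximality, the unrefinable partition [1, …, n2 − 1, n2 + 3, 2 n2] of T n
-- gives L ≥ 2 n2. Then T n = T K + E + L forces K < n2 (K = n2 would need
-- E + r = 2, which these weights cannot produce), hence K = n2 − 1 and r = 1:
-- L = 2 n2 and n2 ∉ λ.
-- The first row of the diagram, that of L, has n2 + 1 cells. If c is the number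
-- of gaps in [1, n2], the rows with more than c cells are exactly those of the c
-- parts in (n2, 2 n2], so the hook length at (1, c + 1) is (n2 − c) + c.

open import Defs
open import Data.Nat
open import Data.Nat.Properties
open import Data.Nat.ListAction using (sum)
open import Data.Nat.ListAction.Properties using (sum-++; sum-↭)
open import Data.Nat.Tactic.RingSolver using (solve-∀)
open import Algebra.Properties.CommutativeSemigroup +-commutativeSemigroup using (interchange; xy∙z≈xz∙y)
open import Data.List using (List; []; _∷_; _∷ʳ_; _++_; length; filter; map; reverse; applyUpTo; upTo; initLast; _∷ʳ′_)
open import Data.List.Properties using (reverse-++; map-applyUpTo; length-++; map-∘; map-id)
open import Data.List.Relation.Binary.Permutation.Propositional.Properties using (↭-reverse; map⁺)
open import Data.List.Relation.Unary.All as All using (All; []; _∷_)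
open import Data.List.Relation.Unary.All.Properties as All using ()
open import Data.List.Relation.Unary.AllPairs as AllPairs using (AllPairs; []; _∷_)
import Data.List.Relation.Unary.AllPairs.Properties as AllPairs
open import Data.List.Relation.Unary.Any as Any using (here; there)
import Data.List.Relation.Unary.Any.Properties as Any
open import Data.List.Membership.DecPropositional _≟_ using (_∈_; _∉_; _∈?_)
open import Data.List.Membership.Propositional.Properties using (∈-filter⁺; ∈-filter⁻; ∈-map⁺; ∈-map⁻; ∈-applyUpTo⁺; ∈-++⁺ˡ; ∈-++⁺ʳ)
open import Data.Product using (_×_; _,_; ∃-syntax; proj₁; proj₂)
open import Data.Sum using (_⊎_; inj₁; inj₂; [_,_]′)
open import Data.Empty using (⊥-elim)
open import Function using (_∘_)
open import Relation.Nullary using (Dec; yes; no; ¬_; ¬?)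
open import Relation.Unary using (Decidable)
open import Relation.Binary.PropositionalEquality
open import Relation.Binary.Definitions using (tri<; tri≈; tri>)

∑ : (ℕ → ℕ) → (from length : ℕ) → ℕ
∑ F i zero    = 0
∑ F i (suc k) = F i + ∑ F (suc i) k

InRange : (from length : ℕ) → ℕ → Set
InRange i k a = i ≤ a × a < i + k

inRange-head : ∀ i k → InRange i (suc k) i
inRange-head i k = ≤-refl , m<m+n i z<s

inRange-tail : ∀ {i k a} → InRange (suc i) k a → InRange i (suc k) a
inRange-tail {i} {k} {a} (i<a , a<) = <⇒≤ i<a , subst (a <_) (sym (+-suc i k)) a<

¬inRange-0 : ∀ i {a} → ¬ InRange i 0 a
¬inRange-0 i {a} (i≤a , a<i+0) = <⇒≱ (subst (a <_) (+-identityʳ i) a<i+0) i≤a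

∑-snoc : ∀ F i k → ∑ F i (suc k) ≡ ∑ F i k + F (i + k)
∑-snoc F i zero    = trans (+-comm (F i) 0) (cong F (sym (+-identityʳ i)))
∑-snoc F i (suc k) = begin
  F i + ∑ F (suc i) (suc k)             ≡⟨ cong (F i +_) (∑-snoc F (suc i) k) ⟩
  F i + (∑ F (suc i) k + F (suc i + k)) ≡⟨ sym (+-assoc (F i) _ _) ⟩
  ∑ F i (suc k) + F (suc i + k)         ≡⟨ cong (λ j → ∑ F i (suc k) + F j) (sym (+-suc i k)) ⟩
  ∑ F i (suc k) + F (i + suc k)         ∎
  where open ≡-Reasoning

∑-split : ∀ F i k k′ → ∑ F i (k + k′) ≡ ∑ F i k + ∑ F (i + k) k′
∑-split F i zero    k′ = cong (λ j → ∑ F j k′) (sym (+-identityʳ i))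
∑-split F i (suc k) k′ = begin
  F i + ∑ F (suc i) (k + k′)                 ≡⟨ cong (F i +_) (∑-split F (suc i) k k′) ⟩
  F i + (∑ F (suc i) k + ∑ F (suc i + k) k′) ≡⟨ sym (+-assoc (F i) _ _) ⟩
  ∑ F i (suc k) + ∑ F (suc i + k) k′         ≡⟨ cong (λ j → ∑ F i (suc k) + ∑ F j k′) (sym (+-suc i k)) ⟩
  ∑ F i (suc k) + ∑ F (i + suc k) k′         ∎
  where open ≡-Reasoning

∑-cong : ∀ {F G} i k → (∀ a → InRange i k a → F a ≡ G a) → ∑ F i k ≡ ∑ G i k
∑-cong i zero    F≡G = refl
∑-cong i (suc k) F≡G = cong₂ _+_ (F≡G i (inRange-head i k)) (∑-cong (suc i) k (λ a → F≡G a ∘ inRange-tail))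

∑-mono-≤ : ∀ {F G} i k → (∀ a → InRange i k a → F a ≤ G a) → ∑ F i k ≤ ∑ G i k
∑-mono-≤ i zero    F≤G = z≤n
∑-mono-≤ i (suc k) F≤G = +-mono-≤ (F≤G i (inRange-head i k)) (∑-mono-≤ (suc i) k (λ a → F≤G a ∘ inRange-tail))

∑-+ : ∀ F G i k → ∑ (λ a → F a + G a) i k ≡ ∑ F i k + ∑ G i k
∑-+ F G i zero    = refl
∑-+ F G i (suc k) = trans (cong (F i + G i +_) (∑-+ F G (suc i) k)) (interchange (F i) (G i) _ _)

∑-const : ∀ c i k → ∑ (λ _ → c) i k ≡ k * c
∑-const c i zero    = refl
∑-const c i (suc k) = cong (c +_) (∑-const c (suc i) k)

∑-ones : ∀ i k → ∑ (λ _ → 1) i k ≡ k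
∑-ones i k = trans (∑-const 1 i k) (*-identityʳ k)

∑-zero : ∀ {F} i k → (∀ a → InRange i k a → F a ≡ 0) → ∑ F i k ≡ 0
∑-zero {F} i k F≡0 = trans (∑-cong i k F≡0) (trans (∑-const 0 i k) (*-zeroʳ k))

+-mono-≤-tight : ∀ {a b c d} → a ≤ c → b ≤ d → a + b ≡ c + d → a ≡ c × b ≡ d
+-mono-≤-tight {a} {b} {c} {d} a≤c b≤d eq with m≤n⇒m<n∨m≡n a≤c
... | inj₁ a<c = ⊥-elim (<-irrefl eq (+-mono-<-≤ a<c b≤d))
... | inj₂ refl = refl , +-cancelˡ-≡ a b d eq

∑-mono-≤-tight : ∀ {F G} i k → (∀ a → InRange i k a → F a ≤ G a) → ∑ F i k ≡ ∑ G i k →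
  ∀ a → InRange i k a → F a ≡ G a
∑-mono-≤-tight i zero    _ _ a a∈ = ⊥-elim (¬inRange-0 i a∈)
∑-mono-≤-tight i (suc k) F≤G eq a a∈ with +-mono-≤-tight (F≤G i (inRange-head i k))
  (∑-mono-≤ (suc i) k (λ b → F≤G b ∘ inRange-tail)) eq | i ≟ a
... | head≡ , _     | yes refl = head≡
... | _     , tail≡ | no i≢a   = ∑-mono-≤-tight (suc i) k (λ b → F≤G b ∘ inRange-tail) tail≡ a
  (≤∧≢⇒< (proj₁ a∈) i≢a , subst (a <_) (+-suc i k) (proj₂ a∈))

∑-prefix-≤ : ∀ F i {k k′} → k ≤ k′ → ∑ F i k ≤ ∑ F i k′
∑-prefix-≤ F i {k} {k′} k≤k′ =
  subst (∑ F i k ≤_) (trans (sym (∑-split F i k (k′ ∸ k))) (cong (∑ F i) (m+[n∸m]≡n k≤k′))) (m≤m+n (∑ F i k) _)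

∑-closed : ∀ (P : ℕ → Set) {F} → P 0 → (∀ {x y} → P x → P y → P (x + y)) →
  ∀ i k → (∀ a → InRange i k a → P (F a)) → P (∑ F i k)
∑-closed P P0 P+ i zero    PF = P0
∑-closed P P0 P+ i (suc k) PF = P+ (PF i (inRange-head i k)) (∑-closed P P0 P+ (suc i) k (λ a → PF a ∘ inRange-tail))

∑-shift : ∀ F i k → ∑ F (suc i) k ≡ ∑ (F ∘ suc) i k
∑-shift F i zero    = refl
∑-shift F i (suc k) = cong (F (suc i) +_) (∑-shift F (suc i) k)

∑-id : ∀ k → ∑ (λ a → a) 1 k ≡ T k
∑-id zero    = refl
∑-id (suc k) = trans (∑-snoc (λ a → a) 1 k) (trans (cong (_+ suc k) (∑-id k)) (+-comm (T k) (suc k)))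

-- The hypothesis says that t ↦ R ∸ t maps [i, i + k) onto [j, j + k).
∑-reflect : ∀ F R i j k → suc R ≡ i + j + k → ∑ F j k ≡ ∑ (λ t → F (R ∸ t)) i k
∑-reflect F R i j zero    eq = refl
∑-reflect F R i j (suc k) eq = begin
  ∑ F j (suc k)                             ≡⟨ ∑-snoc F j k ⟩
  ∑ F j k + F (j + k)                       ≡⟨ +-comm _ (F (j + k)) ⟩
  F (j + k) + ∑ F j k                       ≡⟨ cong₂ _+_ (cong F R∸i≡j+k) (∑-reflect F R (suc i) j k (trans eq (shift i j k))) ⟩
  F (R ∸ i) + ∑ (λ t → F (R ∸ t)) (suc i) k ∎
  where
    open ≡-Reasoning
    shift : ∀ i j k → i + j + suc k ≡ suc i + j + k
    shift = solve-∀
    regroup : ∀ i j k → i + j + suc k ≡ suc (i + (j + k))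
    regroup = solve-∀
    R∸i≡j+k : j + k ≡ R ∸ i
    R∸i≡j+k = sym (trans (cong (_∸ i) (suc-injective (trans eq (regroup i j k)))) (m+n∸m≡n i (j + k)))

∑-applyUpTo : ∀ F n → sum (applyUpTo F n) ≡ ∑ F 0 n
∑-applyUpTo F zero    = refl
∑-applyUpTo F (suc n) = cong (F 0 +_) (trans (∑-applyUpTo (F ∘ suc) n) (sym (∑-shift F 0 n)))

∑-pair : ∀ F K r → ∑ F 1 (K + r + K) ≡ ∑ (λ t → F t + F (suc (K + r + K) ∸ t)) 1 K + ∑ F (suc K) r
∑-pair F K r = begin
  ∑ F 1 (K + r + K)                        ≡⟨ ∑-split F 1 (K + r) K ⟩
  ∑ F 1 (K + r) + ∑ F (suc (K + r)) K      ≡⟨ cong₂ _+_ (∑-split F 1 K r) (∑-reflect F (suc (K + r + K)) 1 (suc (K + r)) K refl) ⟩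
  (∑ F 1 K + ∑ F (suc K) r) + ∑ G 1 K      ≡⟨ xy∙z≈xz∙y (∑ F 1 K) _ _ ⟩
  (∑ F 1 K + ∑ G 1 K) + ∑ F (suc K) r      ≡⟨ cong (_+ ∑ F (suc K) r) (sym (∑-+ F G 1 K)) ⟩
  ∑ (λ t → F t + G t) 1 K + ∑ F (suc K) r  ∎
  where
    open ≡-Reasoning
    G = λ t → F (suc (K + r + K) ∸ t)

indicator : {P : Set} → Dec P → ℕ
indicator (yes _) = 1
indicator (no _)  = 0

module _ {P : Set} where

  indicator-yes : (P? : Dec P) → P → indicator P? ≡ 1
  indicator-yes (yes _) _ = refl
  indicator-yes (no ¬p) p = ⊥-elim (¬p p)

  indicator-no : (P? : Dec P) → ¬ P → indicator P? ≡ 0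
  indicator-no (yes p) ¬p = ⊥-elim (¬p p)
  indicator-no (no _)  _  = refl

  indicator-≤1 : (P? : Dec P) → indicator P? ≤ 1
  indicator-≤1 (yes _) = ≤-refl
  indicator-≤1 (no _)  = z≤n

  indicator-¬? : (P? : Dec P) → indicator P? + indicator (¬? P?) ≡ 1
  indicator-¬? (yes _) = refl
  indicator-¬? (no _)  = refl

  indicator-⇔ : {Q : Set} (P? : Dec P) (Q? : Dec Q) → (P → Q) → (Q → P) → indicator P? ≡ indicator Q?
  indicator-⇔ (yes _) (yes _) _   _   = refl
  indicator-⇔ (yes p) (no ¬q) P→Q _   = ⊥-elim (¬q (P→Q p))
  indicator-⇔ (no ¬p) (yes q) _   Q→P = ⊥-elim (¬p (Q→P q))
  indicator-⇔ (no _)  (no _)  _   _   = refl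

length-filter : ∀ {P : ℕ → Set} (P? : Decidable P) xs → length (filter P? xs) ≡ sum (map (indicator ∘ P?) xs)
length-filter P? []       = refl
length-filter P? (x ∷ xs) with P? x
... | yes _ = cong suc (length-filter P? xs)
... | no _  = length-filter P? xs

∑-indicator-≟ : ∀ (h : ℕ → ℕ) x i k → InRange i k x → ∑ (λ a → indicator (a ≟ x) * h a) i k ≡ h x
∑-indicator-≟ h x i zero    x∈ = ⊥-elim (¬inRange-0 i x∈)
∑-indicator-≟ h x i (suc k) x∈ with i ≟ x
... | no i≢x  = ∑-indicator-≟ h x (suc i) k (≤∧≢⇒< (proj₁ x∈) i≢x , subst (x <_) (+-suc i k) (proj₂ x∈))
... | yes refl = trans (cong₂ _+_ (+-identityʳ (h x)) (∑-zero (suc i) k other≡0)) (+-identityʳ (h x))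
  where
    other≡0 : ∀ a → InRange (suc i) k a → indicator (a ≟ x) * h a ≡ 0
    other≡0 a (x<a , _) = cong (_* h a) (indicator-no (a ≟ x) (>⇒≢ x<a))

𝟙∈ : List ℕ → ℕ → ℕ
𝟙∈ l a = indicator (a ∈? l)

𝟙∉ : List ℕ → ℕ → ℕ
𝟙∉ l a = indicator (¬? (a ∈? l))

𝟙∉-∉ : ∀ l {a} → a ∉ l → 𝟙∉ l a ≡ 1
𝟙∉-∉ l {a} a∉l = indicator-yes (¬? (a ∈? l)) a∉l

𝟙∉-∈ : ∀ l {a} → a ∈ l → 𝟙∉ l a ≡ 0
𝟙∉-∈ l {a} a∈l = indicator-no (¬? (a ∈? l)) (λ a∉l → a∉l a∈l)

𝟙∈+𝟙∉ : ∀ l a → 𝟙∈ l a + 𝟙∉ l a ≡ 1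
𝟙∈+𝟙∉ l a = indicator-¬? (a ∈? l)

𝟙∉≡1⇒∉ : ∀ l {a} → 𝟙∉ l a ≡ 1 → a ∉ l
𝟙∉≡1⇒∉ l {a} gap with a ∈? l
𝟙∉≡1⇒∉ l {a} ()  | yes _
𝟙∉≡1⇒∉ l {a} _   | no a∉l = a∉l

∑-𝟙∉-upto-part : ∀ l g → suc g ∈ l → ∑ (𝟙∉ l) 1 (suc g) ≡ ∑ (𝟙∉ l) 1 g
∑-𝟙∉-upto-part l g g∈l =
  trans (∑-snoc (𝟙∉ l) 1 g) (trans (cong (∑ (𝟙∉ l) 1 g +_) (𝟙∉-∈ l g∈l)) (+-identityʳ _))

𝟙∈-∷ : ∀ {x xs} a → x ∉ xs → 𝟙∈ (x ∷ xs) a ≡ indicator (a ≟ x) + 𝟙∈ xs a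
𝟙∈-∷ {x} {xs} a x∉xs with a ≟ x
... | yes refl = cong suc (sym (indicator-no (a ∈? xs) x∉xs))
... | no a≢x   = indicator-⇔ _ _ (Any.tail a≢x) there

sum-map≡∑ : ∀ (h : ℕ → ℕ) i k l → AllPairs _≢_ l → All (InRange i k) l →
  sum (map h l) ≡ ∑ (λ a → 𝟙∈ l a * h a) i k
sum-map≡∑ h i k []       _                 _          = sym (∑-zero i k (λ _ _ → refl))
sum-map≡∑ h i k (x ∷ xs) (x≢xs ∷ distinct) (x∈ ∷ xs∈) = begin
  h x + sum (map h xs)
    ≡⟨ cong₂ _+_ (sym (∑-indicator-≟ h x i k x∈)) (sum-map≡∑ h i k xs distinct xs∈) ⟩
  ∑ (λ a → indicator (a ≟ x) * h a) i k + ∑ (λ a → 𝟙∈ xs a * h a) i k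
    ≡⟨ sym (∑-+ _ _ i k) ⟩
  ∑ (λ a → indicator (a ≟ x) * h a + 𝟙∈ xs a * h a) i k
    ≡⟨ ∑-cong i k (λ a _ → sym (trans (cong (_* h a) (𝟙∈-∷ a x∉xs))
                                      (*-distribʳ-+ (h a) (indicator (a ≟ x)) (𝟙∈ xs a)))) ⟩
  ∑ (λ a → 𝟙∈ (x ∷ xs) a * h a) i k
    ∎
  where
    open ≡-Reasoning
    x∉xs : x ∉ xs
    x∉xs x∈xs = All.lookup x≢xs x∈xs refl

largest-≥ : ∀ {l x} → x ∈ l → x ≤ largest l
largest-≥ {y ∷ l} (here refl) = m≤m⊔n y (largest l)
largest-≥ {y ∷ l} (there x∈l) = ≤-trans (largest-≥ x∈l) (m≤n⊔m y (largest l))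

largest-∷ʳ : ∀ xs x → AllPairs _<_ (xs ∷ʳ x) → largest (xs ∷ʳ x) ≡ x
largest-∷ʳ []       x _               = ⊔-identityʳ x
largest-∷ʳ (y ∷ xs) x (y<xs ∷ xs-inc) = trans (cong (y ⊔_) (largest-∷ʳ xs x xs-inc))
  (m≤n⇒m⊔n≡n (<⇒≤ (All.head (All.++⁻ʳ xs y<xs))))

reverse-increasing : ∀ l → AllPairs _<_ l → 0 < length l → ∃[ ys ] reverse l ≡ largest l ∷ ys
reverse-increasing l inc 0<length with initLast l
reverse-increasing .[] _ () | []
... | xs ∷ʳ′ x = reverse xs , trans (reverse-++ xs (x ∷ [])) (cong (_∷ reverse xs) (sym (largest-∷ʳ xs x inc)))

parts-in-range : ∀ l → All (0 <_) l → All (InRange 1 (largest l)) l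
parts-in-range l positive = All.tabulate (λ a∈l → All.lookup positive a∈l , s≤s (largest-≥ a∈l))

∈-reverse-head : ∀ l {x ys} → reverse l ≡ x ∷ ys → x ∈ l
∈-reverse-head l rev = Any.reverse⁻ (subst (_ ∈_) (sym rev) (here refl))

∈-missing⁺ : ∀ l {a} → 1 ≤ a → a ≤ largest l → a ∉ l → a ∈ missing l
∈-missing⁺ l {suc a} _ a<L a∉l = ∈-filter⁺ (λ m → ¬? (m ∈? l)) (∈-map⁺ suc (∈-applyUpTo⁺ (λ i → i) a<L)) a∉l

∈-missing⁻ : ∀ l {a} → a ∈ missing l → 1 ≤ a × a ∉ l
∈-missing⁻ l a∈ with ∈-filter⁻ (λ m → ¬? (m ∈? l)) {xs = map suc (upTo (largest l))} a∈
... | a∈suc-upTo , a∉l with ∈-map⁻ suc a∈suc-upTo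
... | _ , _ , refl = s≤s z≤n , a∉l

length-missing : ∀ l → length (missing l) ≡ ∑ (𝟙∉ l) 1 (largest l)
length-missing l = begin
  length (missing l)                                  ≡⟨ length-filter (λ m → ¬? (m ∈? l)) (map suc (upTo L)) ⟩
  sum (map (𝟙∉ l) (map suc (upTo L)))                 ≡⟨ cong (sum ∘ map (𝟙∉ l)) (map-applyUpTo (λ i → i) suc L) ⟩
  sum (map (𝟙∉ l) (applyUpTo suc L))                  ≡⟨ cong sum (map-applyUpTo suc (𝟙∉ l) L) ⟩
  sum (applyUpTo (𝟙∉ l ∘ suc) L)                      ≡⟨ ∑-applyUpTo (𝟙∉ l ∘ suc) L ⟩
  ∑ (𝟙∉ l ∘ suc) 0 L                                  ≡⟨ sym (∑-shift (𝟙∉ l) 0 L) ⟩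
  ∑ (𝟙∉ l) 1 L                                        ∎
  where
    open ≡-Reasoning
    L = largest l

unrefinable-pair-≤1 : ∀ l {s} → Unrefinable l → s ∈ l → ∀ a → 1 ≤ a → a < s → a ≢ s ∸ a →
  𝟙∉ l a + 𝟙∉ l (s ∸ a) ≤ 1
unrefinable-pair-≤1 l {s} unref s∈l a 1≤a a<s a≢s∸a with a ∈? l | (s ∸ a) ∈? l
... | yes _   | s∸a∈? = indicator-≤1 (¬? s∸a∈?)
... | no _    | yes _ = ≤-refl
... | no a∉l  | no s∸a∉l = ⊥-elim (unref a (s ∸ a)
  (∈-missing⁺ l 1≤a (≤-trans (<⇒≤ a<s) s≤L) a∉l)
  (∈-missing⁺ l (m<n⇒0<n∸m a<s) (≤-trans (m∸n≤m s a) s≤L) s∸a∉l)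
  a≢s∸a (subst (_∈ l) (sym (m+[n∸m]≡n (<⇒≤ a<s))) s∈l))
  where s≤L = largest-≥ s∈l

≢∧≥⇒m+m< : ∀ {m a b} → a ≢ b → m ≤ a → m ≤ b → m + m < a + b
≢∧≥⇒m+m< {m} {a} {b} a≢b m≤a m≤b with <-cmp a b
... | tri< a<b _ _ = +-mono-≤-< m≤a (≤-<-trans m≤a a<b)
... | tri≈ _ a≡b _ = ⊥-elim (a≢b a≡b)
... | tri> _ _ b<a = +-mono-<-≤ (≤-<-trans m≤b b<a) m≤b

unrefinable-if-missing-≥ : ∀ l m → (∀ a → a ∈ missing l → m ≤ a) → All (_≤ m + m) l → Unrefinable l
unrefinable-if-missing-≥ l m missing≥m parts≤ a b a∈ b∈ a≢b a+b∈l =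
  <⇒≱ (≢∧≥⇒m+m< a≢b (missing≥m a a∈) (missing≥m b b∈)) (All.lookup parts≤ a+b∈l)

-- [1, …, n2 − 1, n2 + 3, 2 n2] for n2 = p + 1.
witness : ℕ → List ℕ
witness p = applyUpTo suc p ++ (suc p + 3) ∷ (suc p + suc p) ∷ []

module _ {p : ℕ} (3≤p : 3 ≤ p) where

  private
    p+4<2p+2 : suc p + 3 < suc p + suc p
    p+4<2p+2 = +-monoʳ-< (suc p) (s≤s 3≤p)

  witness-distinctPartition : IsDistinctPartition (witness p)
  witness-distinctPartition = increasing , positive , 2≤length
    where
      low<top : ∀ {i} → i < p → All (suc i <_) ((suc p + 3) ∷ (suc p + suc p) ∷ [])
      low<top i<p = ≤-trans (s≤s i<p) (m≤m+n (suc p) 3) ∷ ≤-trans (s≤s i<p) (m≤m+n (suc p) (suc p)) ∷ []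
      increasing : AllPairs _<_ (witness p)
      increasing = AllPairs.++⁺ (AllPairs.applyUpTo⁺₁ suc p (λ i<j _ → s≤s i<j)) ((p+4<2p+2 ∷ []) ∷ [] ∷ [])
        (All.applyUpTo⁺₁ suc p low<top)
      positive : All (0 <_) (witness p)
      positive = All.++⁺ (All.applyUpTo⁺₂ suc p (λ _ → z<s)) (z<s ∷ z<s ∷ [])
      2≤length : 2 ≤ length (witness p)
      2≤length = subst (2 ≤_) (sym (length-++ (applyUpTo suc p))) (m≤n+m 2 (length (applyUpTo suc p)))

  witness-unrefinable : Unrefinable (witness p)
  witness-unrefinable = unrefinable-if-missing-≥ (witness p) (suc p) missing≥ bounded
    where
      missing≥ : ∀ a → a ∈ missing (witness p) → suc p ≤ a
      missing≥ a a∈ with ∈-missing⁻ (witness p) a∈ | suc p ≤? a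
      ... | _                   | yes p<a = p<a
      ... | s≤s z≤n , a∉witness | no p≮a  = ⊥-elim (a∉witness (∈-++⁺ˡ (∈-applyUpTo⁺ suc (≤-pred (≰⇒> p≮a)))))
      bounded : All (_≤ suc p + suc p) (witness p)
      bounded = All.++⁺ (All.applyUpTo⁺₁ suc p (λ i<p → ≤-trans i<p (≤-trans (n≤1+n p) (m≤m+n (suc p) (suc p)))))
        (<⇒≤ p+4<2p+2 ∷ ≤-refl ∷ [])

witness-sum : ∀ p → sum (witness p) ≡ T (3 + p)
witness-sum p = begin
  sum (witness p)                                             ≡⟨ sum-++ (applyUpTo suc p) _ ⟩
  sum (applyUpTo suc p) + (suc p + 3 + (suc p + suc p + 0))   ≡⟨ cong (_+ (suc p + 3 + (suc p + suc p + 0))) lower ⟩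
  T p + (suc p + 3 + (suc p + suc p + 0))                     ≡⟨ regroup p (T p) ⟩
  T (3 + p)                                                   ∎
  where
    open ≡-Reasoning
    lower : sum (applyUpTo suc p) ≡ T p
    lower = trans (∑-applyUpTo suc p) (trans (sym (∑-shift (λ a → a) 0 p)) (∑-id p))
    regroup : ∀ p Tp → Tp + (suc p + 3 + (suc p + suc p + 0)) ≡ 3 + p + (2 + p + (1 + p + Tp))
    regroup = solve-∀

maximal⇒largest-≥ : ∀ {p l} → 3 ≤ p → Maximal (T (3 + p)) l → suc p + suc p ≤ largest l
maximal⇒largest-≥ {p} 3≤p maximal = ≤-trans
  (largest-≥ (∈-++⁺ʳ (applyUpTo suc p) (there (here refl))))
  (maximal (witness p) (witness-distinctPartition 3≤p) (witness-sum p) (witness-unrefinable 3≤p))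

halves : ∀ n → ∃[ K ] ∃[ r ] (r ≤ 1 × n ≡ K + r + K)
halves zero = 0 , 0 , z≤n , refl
halves (suc n) with halves n
... | K , zero , _ , refl = K , 1 , ≤-refl , regroup₀ K
  where
    regroup₀ : ∀ K → suc (K + 0 + K) ≡ K + 1 + K
    regroup₀ = solve-∀
... | K , suc zero , _ , refl = suc K , 0 , z≤n , regroup₁ K
  where
    regroup₁ : ∀ K → suc (K + 1 + K) ≡ suc K + 0 + suc K
    regroup₁ = solve-∀
... | _ , suc (suc _) , s≤s () , _

⌊suc[K+r+K]/2⌋≡K+r : ∀ K {r} → r ≤ 1 → ⌊ suc (K + r + K) /2⌋ ≡ K + r
⌊suc[K+r+K]/2⌋≡K+r zero    z≤n       = refl
⌊suc[K+r+K]/2⌋≡K+r zero    (s≤s z≤n) = refl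
⌊suc[K+r+K]/2⌋≡K+r (suc K) {r} r≤1 =
  trans (cong (λ x → ⌊ suc x /2⌋) (+-suc (suc K + r) K)) (cong suc (⌊suc[K+r+K]/2⌋≡K+r K r≤1))

reflection-distance : ∀ K r t → t ≤ K → suc (K + r + K) ∸ t ≡ t + suc (r + 2 * (K ∸ t))
reflection-distance K r t t≤K = begin
  suc (K + r + K) ∸ t                           ≡⟨ cong (λ k → suc (k + r + k) ∸ t) (sym (m+[n∸m]≡n t≤K)) ⟩
  suc (t + e + r + (t + e)) ∸ t                 ≡⟨ cong (_∸ t) (regroup t e r) ⟩
  t + (t + suc (r + 2 * e)) ∸ t                 ≡⟨ m+n∸m≡n t _ ⟩
  t + suc (r + 2 * e)                           ∎
  where
    open ≡-Reasoning
    e = K ∸ t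
    regroup : ∀ t e r → suc (t + e + r + (t + e)) ≡ t + (t + suc (r + 2 * e))
    regroup = solve-∀

pairs-complementary : ∀ l K r → Unrefinable l → suc (K + r + K) ∈ l → ∑ (𝟙∉ l) 1 (K + r + K) ≡ K + r →
  (∀ t → InRange 1 K t → 𝟙∉ l t + 𝟙∉ l (suc (K + r + K) ∸ t) ≡ 1) × (∀ a → InRange (suc K) r a → a ∉ l)
pairs-complementary l K r unref L∈l gaps =
  ∑-mono-≤-tight 1 K pair≤1 (proj₁ tight) ,
  (λ a a∈ → 𝟙∉≡1⇒∉ l (∑-mono-≤-tight (suc K) r (λ a _ → indicator-≤1 _) (proj₂ tight) a a∈))
  where
    L = suc (K + r + K)
    pair≤1 : ∀ t → InRange 1 K t → 𝟙∉ l t + 𝟙∉ l (L ∸ t) ≤ 1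
    pair≤1 t (1≤t , t<1+K) = unrefinable-pair-≤1 l unref L∈l t 1≤t t<L (<⇒≢ t<L∸t)
      where
        t≤K = ≤-pred t<1+K
        t<L∸t : t < L ∸ t
        t<L∸t = subst (t <_) (sym (reflection-distance K r t t≤K)) (m<m+n t z<s)
        t<L : t < L
        t<L = ≤-<-trans t≤K (s≤s (≤-trans (m≤m+n K r) (m≤m+n (K + r) K)))
    tight : ∑ (λ t → 𝟙∉ l t + 𝟙∉ l (L ∸ t)) 1 K ≡ ∑ (λ _ → 1) 1 K
          × ∑ (𝟙∉ l) (suc K) r ≡ ∑ (λ _ → 1) (suc K) r
    tight = +-mono-≤-tight (∑-mono-≤ 1 K pair≤1) (∑-mono-≤ (suc K) r (λ a _ → indicator-≤1 _)) (begin
      ∑ (λ t → 𝟙∉ l t + 𝟙∉ l (L ∸ t)) 1 K + ∑ (𝟙∉ l) (suc K) r ≡⟨ sym (∑-pair (𝟙∉ l) K r) ⟩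
      ∑ (𝟙∉ l) 1 (K + r + K)                                  ≡⟨ gaps ⟩
      K + r                                                   ≡⟨ sym (cong₂ _+_ (∑-ones 1 K) (∑-ones (suc K) r)) ⟩
      ∑ (λ _ → 1) 1 K + ∑ (λ _ → 1) (suc K) r                 ∎)
      where open ≡-Reasoning

complementary-pair-sum : ∀ l t s d → s ≡ t + d → 𝟙∉ l t + 𝟙∉ l s ≡ 1 →
  𝟙∈ l t * t + 𝟙∈ l s * s ≡ t + 𝟙∉ l t * d
complementary-pair-sum l t s d s≡t+d one-gap with t ∈? l | s ∈? l
complementary-pair-sum l t s d s≡t+d ()      | yes _ | yes _
complementary-pair-sum l t s d s≡t+d _       | yes _ | no _  = +-identityʳ (t + 0)
complementary-pair-sum l t s d s≡t+d _       | no _  | yes _ =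
  trans (+-identityʳ s) (trans s≡t+d (cong (t +_) (sym (+-identityʳ d))))
complementary-pair-sum l t s d s≡t+d ()      | no _  | no _

sum-of-parts : ∀ l K r → suc (K + r + K) ∈ l →
  (∀ t → InRange 1 K t → 𝟙∉ l t + 𝟙∉ l (suc (K + r + K) ∸ t) ≡ 1) → (∀ a → InRange (suc K) r a → a ∉ l) →
  ∑ (λ a → 𝟙∈ l a * a) 1 (suc (K + r + K)) ≡ T K + ∑ (λ t → 𝟙∉ l t * suc (r + 2 * (K ∸ t))) 1 K + suc (K + r + K)
sum-of-parts l K r L∈l pairs middle = begin
  ∑ F 1 (suc (K + r + K))
    ≡⟨ ∑-snoc F 1 (K + r + K) ⟩
  ∑ F 1 (K + r + K) + F L
    ≡⟨ cong₂ _+_ (∑-pair F K r) (cong (_* L) (indicator-yes (L ∈? l) L∈l)) ⟩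
  ∑ (λ t → F t + F (L ∸ t)) 1 K + ∑ F (suc K) r + 1 * L
    ≡⟨ cong₂ (λ x y → x + y + 1 * L) (∑-cong 1 K pair) (∑-zero (suc K) r middle≡0) ⟩
  ∑ (λ t → t + W t) 1 K + 0 + 1 * L
    ≡⟨ cong₂ _+_ (trans (+-identityʳ _) (∑-+ (λ t → t) W 1 K)) (*-identityˡ L) ⟩
  ∑ (λ t → t) 1 K + ∑ W 1 K + L
    ≡⟨ cong (λ x → x + ∑ W 1 K + L) (∑-id K) ⟩
  T K + ∑ W 1 K + L
    ∎
  where
    open ≡-Reasoning
    L = suc (K + r + K)
    F = λ a → 𝟙∈ l a * a
    W = λ t → 𝟙∉ l t * suc (r + 2 * (K ∸ t))
    pair : ∀ t → InRange 1 K t → F t + F (L ∸ t) ≡ t + W t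
    pair t t∈ = complementary-pair-sum l t (L ∸ t) (suc (r + 2 * (K ∸ t)))
      (reflection-distance K r t (≤-pred (proj₂ t∈))) (pairs t t∈)
    middle≡0 : ∀ a → InRange (suc K) r a → F a ≡ 0
    middle≡0 a a∈ = cong (_* a) (indicator-no (a ∈? l) (middle a a∈))

T-mono-≤ : ∀ {a b} → a ≤ b → T a ≤ T b
T-mono-≤ {zero}  _         = z≤n
T-mono-≤ {suc a} (s≤s a≤b) = +-mono-≤ (s≤s a≤b) (T-mono-≤ a≤b)

m+m≤n+n⇒m≤n : ∀ {m n} → m + m ≤ n + n → m ≤ n
m+m≤n+n⇒m≤n {m} {n} m+m≤n+n with m ≤? n
... | yes m≤n = m≤n
... | no  m≰n = ⊥-elim (<⇒≱ (+-mono-< (≰⇒> m≰n) (≰⇒> m≰n)) m+m≤n+n)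

0/1-weight : ∀ {x} w → x ≤ 1 → 3 ≤ w → x * w ≡ 0 ⊎ 3 ≤ x * w
0/1-weight w z≤n       _   = inj₁ refl
0/1-weight w (s≤s z≤n) 3≤w = inj₂ (subst (3 ≤_) (sym (+-identityʳ w)) 3≤w)

last-weight≢2 : ∀ {x r} → x ≤ 1 → r ≤ 1 → x * suc (r + 0) + r ≢ 2
last-weight≢2 z≤n       z≤n       ()
last-weight≢2 z≤n       (s≤s z≤n) ()
last-weight≢2 (s≤s z≤n) z≤n       ()
last-weight≢2 (s≤s z≤n) (s≤s z≤n) ()

weighted-gaps+r≢2 : ∀ (g : ℕ → ℕ) K r → 1 ≤ K → r ≤ 1 → (∀ t → g t ≤ 1) →
  ∑ (λ t → g t * suc (r + 2 * (K ∸ t))) 1 K + r ≢ 2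
weighted-gaps+r≢2 g (suc K′) r _ r≤1 g≤1 eq =
  [ early≢0 , early≱3 ]′ (∑-closed (λ x → x ≡ 0 ⊎ 3 ≤ x) (inj₁ refl) closed 1 K′ early)
  where
    W = λ t → g t * suc (r + 2 * (suc K′ ∸ t))
    closed : ∀ {x y} → x ≡ 0 ⊎ 3 ≤ x → y ≡ 0 ⊎ 3 ≤ y → x + y ≡ 0 ⊎ 3 ≤ x + y
    closed (inj₁ refl) y∈ = y∈
    closed {x} {y} (inj₂ 3≤x) _ = inj₂ (≤-trans 3≤x (m≤m+n x y))
    early : ∀ t → InRange 1 K′ t → W t ≡ 0 ⊎ 3 ≤ W t
    early t (_ , t<1+K′) = 0/1-weight _ (g≤1 t)
      (s≤s (≤-trans (*-monoʳ-≤ 2 (m<n⇒0<n∸m (s≤s t<1+K′))) (m≤n+m _ r)))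
    total : ∑ W 1 K′ + g (suc K′) * suc (r + 0) + r ≡ 2
    total = trans (cong (_+ r) (sym (trans (∑-snoc W 1 K′)
      (cong (λ d → ∑ W 1 K′ + g (suc K′) * suc (r + 2 * d)) (n∸n≡0 K′))))) eq
    early≢0 : ∑ W 1 K′ ≢ 0
    early≢0 early≡0 = last-weight≢2 (g≤1 (suc K′)) r≤1
      (trans (cong (λ x → x + g (suc K′) * suc (r + 0) + r) (sym early≡0)) total)
    early≱3 : 3 ≰ ∑ W 1 K′
    early≱3 3≤early = <⇒≱ ≤-refl (subst (3 ≤_) total (≤-trans 3≤early (≤-trans (m≤m+n _ _) (m≤m+n _ r))))

largest-part-forced : ∀ n2 K r (g : ℕ → ℕ) → 1 ≤ n2 → r ≤ 1 → (∀ t → g t ≤ 1) →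
  T (2 + n2) ≡ T K + ∑ (λ t → g t * suc (r + 2 * (K ∸ t))) 1 K + suc (K + r + K) →
  n2 + n2 ≤ suc (K + r + K) → suc K ≡ n2 × r ≡ 1
largest-part-forced n2 K r g 1≤n2 r≤1 g≤1 sum≡ 2n2≤L with <-cmp K n2
... | tri< K<n2 _ _ = K<n2-case r≤1 2n2≤L
  where
    K<n2-case : r ≤ 1 → n2 + n2 ≤ suc (K + r + K) → suc K ≡ n2 × r ≡ 1
    K<n2-case z≤n       2n2≤L = ⊥-elim (<⇒≱ (s≤s L<2K+2) (≤-trans (+-mono-≤ K<n2 K<n2) 2n2≤L))
      where
        L<2K+2 : K + 0 + K < K + suc K
        L<2K+2 = subst (λ x → x + K < K + suc K) (sym (+-identityʳ K)) (+-monoʳ-< K ≤-refl)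
    K<n2-case (s≤s z≤n) 2n2≤L =
      ≤-antisym K<n2 (m+m≤n+n⇒m≤n (subst (n2 + n2 ≤_) (cong suc (+-assoc K 1 K)) 2n2≤L)) , refl
... | tri≈ _ refl _ = ⊥-elim (weighted-gaps+r≢2 g K r 1≤n2 r≤1 g≤1 (+-cancelˡ-≡ (T K + suc (K + K)) _ 2 (begin
      T K + suc (K + K) + (E + r)   ≡⟨ regroup₁ (T K) K E r ⟩
      T K + E + suc (K + r + K)     ≡⟨ sym sum≡ ⟩
      T (2 + K)                     ≡⟨ regroup₂ (T K) K ⟩
      T K + suc (K + K) + 2         ∎)))
  where
    open ≡-Reasoning
    E = ∑ (λ t → g t * suc (r + 2 * (K ∸ t))) 1 K
    regroup₁ : ∀ Tk K E r → Tk + suc (K + K) + (E + r) ≡ Tk + E + suc (K + r + K)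
    regroup₁ = solve-∀
    regroup₂ : ∀ Tk K → suc (suc K) + (suc K + Tk) ≡ Tk + suc (K + K) + 2
    regroup₂ = solve-∀
... | tri> _ _ n2<K = ⊥-elim (<-irrefl sum≡ (begin-strict
      T (2 + n2)                 ≡⟨⟩
      2 + n2 + T (suc n2)        <⟨ +-mono-<-≤ 2+n2<L (T-mono-≤ n2<K) ⟩
      L + T K                    ≡⟨ +-comm L (T K) ⟩
      T K + L                    ≤⟨ +-monoˡ-≤ L (m≤m+n (T K) E) ⟩
      T K + E + L                ∎))
  where
    open ≤-Reasoning
    L = suc (K + r + K)
    E = ∑ (λ t → g t * suc (r + 2 * (K ∸ t))) 1 K
    2+n2<L : 2 + n2 < L
    2+n2<L = s≤s (≤-<-trans n2<K (<-≤-trans (m<m+n K (≤-trans (s≤s z≤n) n2<K)) (+-monoˡ-≤ K (m≤m+n K r))))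

rowOf≡∑ : ∀ l g → rowOf l g ≡ ∑ (𝟙∉ l) 0 g
rowOf≡∑ l g = begin
  rowOf l g                          ≡⟨ length-filter (λ s → ¬? (s ∈? l)) (upTo g) ⟩
  sum (map (𝟙∉ l) (applyUpTo (λ i → i) g)) ≡⟨ cong sum (map-applyUpTo (λ i → i) (𝟙∉ l) g) ⟩
  sum (applyUpTo (𝟙∉ l) g)           ≡⟨ ∑-applyUpTo (𝟙∉ l) g ⟩
  ∑ (𝟙∉ l) 0 g                       ∎
  where open ≡-Reasoning

rowOf-mono-≤ : ∀ l {a b} → a ≤ b → rowOf l a ≤ rowOf l b
rowOf-mono-≤ l {a} {b} a≤b = subst₂ _≤_ (sym (rowOf≡∑ l a)) (sym (rowOf≡∑ l b)) (∑-prefix-≤ (𝟙∉ l) 0 a≤b)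

rowOf-suc : ∀ l a → 0 ∉ l → rowOf l (suc a) ≡ suc (∑ (𝟙∉ l) 1 a)
rowOf-suc l a 0∉l = trans (rowOf≡∑ l (suc a)) (cong (_+ ∑ (𝟙∉ l) 1 a) (𝟙∉-∉ l 0∉l))

hook-first-row : ∀ l {L ys} j → reverse l ≡ L ∷ ys → j ≤ rowOf l L →
  hook (rows l) 1 j ≡ rowOf l L ∸ j + sum (map (λ a → indicator (j ≤? rowOf l a)) l)
hook-first-row l {L} {ys} j rev j≤row = begin
  hook (rows l) 1 j                                                ≡⟨ cong (λ xs → hook (map (rowOf l) xs) 1 j) rev ⟩
  rowOf l L ∸ j + length (filter (j ≤?_) (map (rowOf l) ys)) + 1   ≡⟨ +-assoc (rowOf l L ∸ j) _ 1 ⟩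
  rowOf l L ∸ j + (length (filter (j ≤?_) (map (rowOf l) ys)) + 1) ≡⟨ cong (rowOf l L ∸ j +_) below+1 ⟩
  rowOf l L ∸ j + sum (map h l)                                     ∎
  where
    open ≡-Reasoning
    h = λ a → indicator (j ≤? rowOf l a)
    below+1 : length (filter (j ≤?_) (map (rowOf l) ys)) + 1 ≡ sum (map h l)
    below+1 = begin
      length (filter (j ≤?_) (map (rowOf l) ys)) + 1 ≡⟨ cong (_+ 1) below ⟩
      sum (map h ys) + 1                             ≡⟨ +-comm (sum (map h ys)) 1 ⟩
      1 + sum (map h ys)                             ≡⟨ cong (_+ sum (map h ys)) (sym (indicator-yes (j ≤? rowOf l L) j≤row)) ⟩
      sum (map h (L ∷ ys))                           ≡⟨ cong (sum ∘ map h) (sym rev) ⟩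
      sum (map h (reverse l))                        ≡⟨ sum-↭ (map⁺ h (↭-reverse l)) ⟩
      sum (map h l)                                  ∎
      where
        below : length (filter (j ≤?_) (map (rowOf l) ys)) ≡ sum (map h ys)
        below = trans (length-filter (j ≤?_) (map (rowOf l) ys)) (cong sum (sym (map-∘ ys)))

rowOf-∉ : ∀ l g → 0 ∉ l → g ∉ l → rowOf l g ≡ ∑ (𝟙∉ l) 1 g
rowOf-∉ l zero    _   _   = refl
rowOf-∉ l (suc g) 0∉l g∉l = begin
  rowOf l (suc g)              ≡⟨ rowOf-suc l g 0∉l ⟩
  suc (∑ (𝟙∉ l) 1 g)           ≡⟨ +-comm 1 _ ⟩
  ∑ (𝟙∉ l) 1 g + 1             ≡⟨ cong (∑ (𝟙∉ l) 1 g +_) (sym (𝟙∉-∉ l g∉l)) ⟩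
  ∑ (𝟙∉ l) 1 g + 𝟙∉ l (suc g)  ≡⟨ sym (∑-snoc (𝟙∉ l) 1 g) ⟩
  ∑ (𝟙∉ l) 1 (suc g)           ∎
  where open ≡-Reasoning

rowOf-∈ : ∀ l g → 0 ∉ l → suc g ∈ l → rowOf l (suc g) ≡ suc (∑ (𝟙∉ l) 1 (suc g))
rowOf-∈ l g 0∉l g∈l = trans (rowOf-suc l g 0∉l) (cong suc (sym (∑-𝟙∉-upto-part l g g∈l)))

upper-parts≡lower-gaps : ∀ l m → ∑ (𝟙∉ l) 1 (m + m) ≡ m → ∑ (𝟙∈ l) (suc m) m ≡ ∑ (𝟙∉ l) 1 m
upper-parts≡lower-gaps l m gaps = +-cancelʳ-≡ (∑ (𝟙∉ l) (suc m) m) _ _ (begin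
  ∑ (𝟙∈ l) (suc m) m + ∑ (𝟙∉ l) (suc m) m   ≡⟨ sym (∑-+ (𝟙∈ l) (𝟙∉ l) (suc m) m) ⟩
  ∑ (λ a → 𝟙∈ l a + 𝟙∉ l a) (suc m) m       ≡⟨ ∑-cong (suc m) m (λ a _ → 𝟙∈+𝟙∉ l a) ⟩
  ∑ (λ _ → 1) (suc m) m                     ≡⟨ ∑-ones (suc m) m ⟩
  m                                         ≡⟨ sym gaps ⟩
  ∑ (𝟙∉ l) 1 (m + m)                        ≡⟨ ∑-split (𝟙∉ l) 1 m m ⟩
  ∑ (𝟙∉ l) 1 m + ∑ (𝟙∉ l) (suc m) m         ∎)
  where open ≡-Reasoning

long-rows≡upper-parts : ∀ l m → AllPairs _≢_ l → All (InRange 1 (m + m)) l → 0 ∉ l → m ∉ l →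
  sum (map (λ a → indicator (suc (∑ (𝟙∉ l) 1 m) ≤? rowOf l a)) l) ≡ ∑ (𝟙∈ l) (suc m) m
long-rows≡upper-parts l m distinct bounds 0∉l m∉l = begin
  sum (map h l)                                                ≡⟨ sum-map≡∑ h 1 (m + m) l distinct bounds ⟩
  ∑ (λ a → 𝟙∈ l a * h a) 1 (m + m)                             ≡⟨ ∑-split _ 1 m m ⟩
  ∑ (λ a → 𝟙∈ l a * h a) 1 m + ∑ (λ a → 𝟙∈ l a * h a) (suc m) m ≡⟨ cong₂ _+_ (∑-zero 1 m short) (∑-cong _ m long) ⟩
  ∑ (𝟙∈ l) (suc m) m                                           ∎
  where
    open ≡-Reasoning
    c = ∑ (𝟙∉ l) 1 m
    h = λ a → indicator (suc c ≤? rowOf l a)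
    short : ∀ a → InRange 1 m a → 𝟙∈ l a * h a ≡ 0
    short a (_ , a<1+m) = trans (cong (𝟙∈ l a *_) (indicator-no (suc c ≤? rowOf l a) row≤c)) (*-zeroʳ (𝟙∈ l a))
      where
        row≤c : suc c ≰ rowOf l a
        row≤c = <⇒≱ (s≤s (≤-trans (rowOf-mono-≤ l (≤-pred a<1+m)) (≤-reflexive (rowOf-∉ l m 0∉l m∉l))))
    long : ∀ a → InRange (suc m) m a → 𝟙∈ l a * h a ≡ 𝟙∈ l a
    long a (m<a , _) = trans (cong (𝟙∈ l a *_) (indicator-yes (suc c ≤? rowOf l a) c<row)) (*-identityʳ (𝟙∈ l a))
      where
        c<row : suc c ≤ rowOf l a
        c<row = subst (_≤ rowOf l a) (rowOf-suc l m 0∉l) (rowOf-mono-≤ l m<a)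

hook-at-middle : ∀ l m {ys} → AllPairs _≢_ l → All (InRange 1 (m + m)) l → reverse l ≡ (m + m) ∷ ys → m ∉ l →
  ∑ (𝟙∉ l) 1 (m + m) ≡ m → ∃[ z ] (1 ≤ z × z ≤ m × suc z ≤ rowLen (rows l) 1 × hook (rows l) 1 (suc z) ≡ m)
hook-at-middle l zero _ _ rev m∉l _ = ⊥-elim (m∉l (∈-reverse-head l rev))
hook-at-middle l m@(suc m′) distinct bounds rev m∉l gaps =
  c , 1≤c , c≤m , subst (suc c ≤_) (sym rowLen≡) (s≤s c≤m) , hook≡
  where
    open ≡-Reasoning
    c = ∑ (𝟙∉ l) 1 m
    0∉l : 0 ∉ l
    0∉l 0∈l with All.lookup bounds 0∈l
    ... | () , _
    1≤c : 1 ≤ c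
    1≤c = subst (1 ≤_) (sym (trans (∑-snoc (𝟙∉ l) 1 m′) (cong (∑ (𝟙∉ l) 1 m′ +_) (𝟙∉-∉ l m∉l))))
      (m≤n+m 1 _)
    c≤m : c ≤ m
    c≤m = subst (c ≤_) (∑-ones 1 m) (∑-mono-≤ 1 m (λ a _ → indicator-≤1 _))
    row-L : rowOf l (m + m) ≡ suc m
    row-L = trans (rowOf-∈ l (m′ + m) 0∉l (∈-reverse-head l rev)) (cong suc gaps)
    rowLen≡ : rowLen (rows l) 1 ≡ suc m
    rowLen≡ = trans (cong (λ xs → rowLen (map (rowOf l) xs) 1) rev) row-L
    hook≡ : hook (rows l) 1 (suc c) ≡ m
    hook≡ = begin
      hook (rows l) 1 (suc c)
        ≡⟨ hook-first-row l (suc c) rev (subst (suc c ≤_) (sym row-L) (s≤s c≤m)) ⟩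
      rowOf l (m + m) ∸ suc c + sum (map (λ a → indicator (suc c ≤? rowOf l a)) l)
        ≡⟨ cong₂ (λ x y → x ∸ suc c + y) row-L (long-rows≡upper-parts l m distinct bounds 0∉l m∉l) ⟩
      m ∸ c + ∑ (𝟙∈ l) (suc m) m
        ≡⟨ cong (m ∸ c +_) (upper-parts≡lower-gaps l m gaps) ⟩
      m ∸ c + c
        ≡⟨ m∸n+n≡m c≤m ⟩
      m ∎

largest-∈ : ∀ l → IsDistinctPartition l → largest l ∈ l
largest-∈ l (increasing , _ , 2≤length) =
  ∈-reverse-head l (proj₂ (reverse-increasing l increasing (≤-trans (s≤s z≤n) 2≤length)))

sum≡∑-parts : ∀ l → IsDistinctPartition l → sum l ≡ ∑ (λ a → 𝟙∈ l a * a) 1 (largest l)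
sum≡∑-parts l (increasing , positive , _) = trans (cong sum (sym (map-id l)))
  (sum-map≡∑ (λ a → a) 1 (largest l) l (AllPairs.map <⇒≢ increasing) (parts-in-range l positive))

ubar-gap-count : ∀ {N} l → InUbar N l → ∑ (𝟙∉ l) 1 (largest l) ≡ ⌊ largest l /2⌋
ubar-gap-count l (_ , _ , _ , _ , #missing) = trans (sym (length-missing l)) #missing

ubar-largest-and-middle : ∀ n2 → 4 ≤ n2 → ∀ l → InUbar (T (2 + n2)) l → largest l ≡ n2 + n2 × n2 ∉ l
ubar-largest-and-middle n2@(suc p) (s≤s 3≤p) l ubar@(partition@(_ , positive , _) , sum≡ , unref , maximal , _)
  with halves (pred (largest l))
... | K , r , r≤1 , pred≡ = L≡2n2 , subst (_∉ l) sucK≡n2 (middle (suc K) middle∈)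
  where
    open ≡-Reasoning
    L = largest l
    M = K + r + K
    L≡ : L ≡ suc M
    L≡ = trans (sym (suc-pred L {{>-nonZero (All.lookup positive (largest-∈ l partition))}})) (cong suc pred≡)
    sucM∈l : suc M ∈ l
    sucM∈l = subst (_∈ l) L≡ (largest-∈ l partition)
    gaps : ∑ (𝟙∉ l) 1 M ≡ K + r
    gaps = begin
      ∑ (𝟙∉ l) 1 M           ≡⟨ sym (∑-𝟙∉-upto-part l M sucM∈l) ⟩
      ∑ (𝟙∉ l) 1 (suc M)     ≡⟨ subst (λ L → ∑ (𝟙∉ l) 1 L ≡ ⌊ L /2⌋) L≡ (ubar-gap-count l ubar) ⟩
      ⌊ suc M /2⌋            ≡⟨ ⌊suc[K+r+K]/2⌋≡K+r K r≤1 ⟩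
      K + r                  ∎
    complementary = pairs-complementary l K r unref sucM∈l gaps
    middle = proj₂ complementary
    E = ∑ (λ t → 𝟙∉ l t * suc (r + 2 * (K ∸ t))) 1 K
    sum-parts : T (2 + n2) ≡ T K + E + suc M
    sum-parts = begin
      T (2 + n2)                       ≡⟨ sym sum≡ ⟩
      sum l                            ≡⟨ subst (λ L → sum l ≡ ∑ (λ a → 𝟙∈ l a * a) 1 L) L≡ (sum≡∑-parts l partition) ⟩
      ∑ (λ a → 𝟙∈ l a * a) 1 (suc M)   ≡⟨ sum-of-parts l K r sucM∈l (proj₁ complementary) middle ⟩
      T K + E + suc M                  ∎
    forced : suc K ≡ n2 × r ≡ 1
    forced = largest-part-forced n2 K r (𝟙∉ l) (s≤s z≤n) r≤1 (λ t → indicator-≤1 _) sum-parts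
      (subst (n2 + n2 ≤_) L≡ (maximal⇒largest-≥ {l = l} 3≤p maximal))
    sucK≡n2 = proj₁ forced
    r≡1 = proj₂ forced
    middle∈ : InRange (suc K) r (suc K)
    middle∈ = subst (λ r → InRange (suc K) r (suc K)) (sym r≡1) (inRange-head (suc K) 0)
    L≡2n2 : L ≡ n2 + n2
    L≡2n2 = begin
      L                  ≡⟨ L≡ ⟩
      suc (K + r + K)    ≡⟨ cong (λ r → suc (K + r + K)) r≡1 ⟩
      suc (K + 1 + K)    ≡⟨ cong suc (+-assoc K 1 K) ⟩
      suc K + suc K      ≡⟨ cong₂ _+_ sucK≡n2 sucK≡n2 ⟩
      n2 + n2            ∎

first-row-hook-n2 : ∀ n2 → 4 ≤ n2 → ∀ l → InUbar (T (2 + n2)) l →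
  ∃[ z ] (1 ≤ z × z ≤ n2 × suc z ≤ rowLen (rows l) 1 × hook (rows l) 1 (suc z) ≡ n2)
first-row-hook-n2 n2 4≤n2 l ubar@((increasing , positive , 2≤length) , _)
  with ubar-largest-and-middle n2 4≤n2 l ubar | reverse-increasing l increasing (≤-trans (s≤s z≤n) 2≤length)
... | L≡2n2 , n2∉l | ys , rev = hook-at-middle l n2 (AllPairs.map <⇒≢ increasing)
  (subst (λ L → All (InRange 1 L) l) L≡2n2 (parts-in-range l positive))
  (subst (λ L → reverse l ≡ L ∷ ys) L≡2n2 rev) n2∉l
  (trans (subst (λ L → ∑ (𝟙∉ l) 1 L ≡ ⌊ L /2⌋) L≡2n2 (ubar-gap-count l ubar)) (sym (n≡⌊n+n/2⌋ n2)))

lemma3p2 : (k : ℕ) → 4 ≤ k → (l : List ℕ) → InUbar (T (2 * k ∸ 1)) l →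
    ∃[ z ] (1 ≤ z × z ≤ (2 * k ∸ 1) ∸ 2 × suc z ≤ rowLen (rows l) 1
      × hook (rows l) 1 (suc z) ≡ (2 * k ∸ 1) ∸ 2)
lemma3p2 k 4≤k l ubar = first-row-hook-n2 ((2 * k ∸ 1) ∸ 2) 4≤n-2 l (subst (λ n → InUbar (T n) l) n≡2+[n-2] ubar)
  where
    6≤n : 6 ≤ 2 * k ∸ 1
    6≤n = ≤-trans (n≤1+n 6) (∸-monoˡ-≤ 1 (*-monoʳ-≤ 2 4≤k))
    4≤n-2 : 4 ≤ (2 * k ∸ 1) ∸ 2
    4≤n-2 = ∸-monoˡ-≤ 2 6≤n
    n≡2+[n-2] : 2 * k ∸ 1 ≡ 2 + ((2 * k ∸ 1) ∸ 2)
    n≡2+[n-2] = sym (m+[n∸m]≡n (≤-trans (s≤s (s≤s z≤n)) 6≤n))
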